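{- Let $G=(V,E)$ be a finite connected graph on $n$ vertices whose resistance curvature is bounded from below by $K>0$, i.e. $\kappa_i\ge K$ for all $i$. Then $$K\leq \frac12\,\frac{n}{n-1}.$$
   Context: Throughout, $G=(V,E)$ is a finite, simple, connected graph with vertices $v_1,\dots,v_n$, $n\ge 2$. Let $D$ be the diagonal degree matrix, $A$ the adjacency matrix, and $\Gamma = D-A+\frac1n J$, where $J$ is the $n\times n$ all-ones matrix. The resistance matrix $\Omega$ is defined by $\Omega_{ij}=(\Gamma^{ -1})_{ii}+(\Gamma^{ -1})_{jj}-2(\Gamma^{ -1})_{ij}$; it is invertible. The resistance curvature is the unique vector $\kappa\in\mathbb{R}^n$ with $\Omega\kappa=\mathbf{1}$, $\mathbf 1=(1,\dots,1)$.
   Formalization: The lower bound K on the resistance curvature ranges over the positive rationals. -}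

module Defs where

open import Data.Nat using (ℕ; zero; suc; NonZero)
open import Data.Fin using (Fin; zero; suc)
open import Data.Fin.Properties using (_≟_)
open import Data.Bool using (Bool; true; false; if_then_else_)
open import Data.Integer using (+_)
open import Data.Rational using (ℚ; 0ℚ; 1ℚ; _+_; _*_; _-_; _/_)
open import Data.Product using (Σ; _×_)
open import Relation.Binary.PropositionalEquality using (_≡_)
open import Relation.Nullary using (¬_; does)

record SimpleGraph (n : ℕ) : Set where
  field
    adj     : Fin n → Fin n → Bool
    symm    : ∀ i j → adj i j ≡ adj j i
    irrefl  : ∀ i → adj i i ≡ false

open SimpleGraph public

data Walk {n : ℕ} (G : SimpleGraph n) : Fin n → Fin n → Set where
  here  : ∀ {i} → Walk G i i
  step  : ∀ {i j k} → adj G i j ≡ true → Walk G j k → Walk G i k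

Connected : {n : ℕ} → SimpleGraph n → Set
Connected G = ∀ i j → Walk G i j

Σ[_] : (n : ℕ) → (Fin n → ℚ) → ℚ
Σ[ zero ] f = 0ℚ
Σ[ suc n ] f = f zero + Σ[ n ] (λ i → f (suc i))

Matrix : ℕ → Set
Matrix n = Fin n → Fin n → ℚ

Vector : ℕ → Set
Vector n = Fin n → ℚ

b2ℚ : Bool → ℚ
b2ℚ true  = 1ℚ
b2ℚ false = 0ℚ

adjMatrix : {n : ℕ} → SimpleGraph n → Matrix n
adjMatrix G i j = b2ℚ (adj G i j)

degree : {n : ℕ} → SimpleGraph n → Fin n → ℚ
degree {n} G i = Σ[ n ] (λ j → adjMatrix G i j)

idMatrix : (n : ℕ) → Matrix n
idMatrix n i j = if does (i ≟ j) then 1ℚ else 0ℚ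

degMatrix : {n : ℕ} → SimpleGraph n → Matrix n
degMatrix {n} G i j = if does (i ≟ j) then degree G i else 0ℚ

Gamma : {n : ℕ} → .{{_ : NonZero n}} → SimpleGraph n → Matrix n
Gamma {n} G i j = (degMatrix G i j - adjMatrix G i j) + (+ 1 / n)

matMul : {n : ℕ} → Matrix n → Matrix n → Matrix n
matMul {n} M N i j = Σ[ n ] (λ k → M i k * N k j)

matVec : {n : ℕ} → Matrix n → Vector n → Vector n
matVec {n} M v i = Σ[ n ] (λ k → M i k * v k)

IsInverse : {n : ℕ} → Matrix n → Matrix n → Set
IsInverse {n} M N = (∀ i j → matMul M N i j ≡ idMatrix n i j)
                  × (∀ i j → matMul N M i j ≡ idMatrix n i j)

resistance : {n : ℕ} → Matrix n → Matrix n
resistance Γinv i j = (Γinv i i + Γinv j j) - ((+ 2 / 1) * Γinv i j)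

IsResistanceCurvature : {n : ℕ} → .{{_ : NonZero n}} →
  SimpleGraph n → Matrix n → Vector n → Set
IsResistanceCurvature {n} G Γinv κ =
  IsInverse (Gamma G) Γinv × (∀ i → matVec (resistance Γinv) κ i ≡ 1ℚ)

-- Γ = L + J/n is positive semidefinite (L is the graph Laplacian), so its inverse M gives
-- ⟨ x ∣ M ∣ x ⟩ ≥ 2 z·x - ⟨ z ∣ Γ ∣ z ⟩ for every z. Taking x = eᵢ - eⱼ and z = x/n, and using
-- that degrees are at most n - 1, yields Ωᵢⱼ ≥ 2/n off the diagonal, hence 𝟙ᵀΩ𝟙 ≥ 2(n - 1).
-- On the other hand, when Σ x = 0 the diagonal terms of Ωᵢⱼ = Mᵢᵢ + Mⱼⱼ - 2Mᵢⱼ cancel in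
-- ⟨ x ∣ Ω ∣ x ⟩, leaving -2⟨ x ∣ M ∣ x ⟩ ≤ 0; since Ω κ = 𝟙, for x = n κ - (Σ κ) 𝟙 this says
-- (Σ κ) · 𝟙ᵀΩ𝟙 ≤ n². As Σ κ ≥ n K, we get n K · 2(n - 1) ≤ n², i.e. K ≤ n / (2(n - 1)).

module Submission where

open import Defs
open import Algebra.Bundles using (CommutativeRing)
open import Data.Nat using (ℕ; zero; suc; NonZero)
open import Data.Fin using (Fin; zero; suc)
open import Data.Fin.Properties using (_≟_)
open import Data.Bool using (true; false; if_then_else_)
open import Data.Integer using (+_)
import Data.Integer as ℤ
import Data.Integer.Tactic.RingSolver as ℤ
open import Data.Rational
  using (ℚ; 0ℚ; 1ℚ; ½; _+_; _*_; _-_; -_; _/_; _≤_; _<_; toℚᵘ; nonNegative; nonPositive; positive)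
open import Data.Rational.Properties hiding (_≟_)
open import Data.Rational.Properties using () renaming (_≟_ to _≟ℚ_)
import Data.Rational.Unnormalised as ℚᵘ
import Data.Rational.Unnormalised.Properties as ℚᵘ
open import Data.Product using (proj₁; proj₂)
open import Data.Sum using (inj₁; inj₂)
open import Function using (_∘_; flip)
open import Relation.Binary.PropositionalEquality
open import Relation.Nullary using (¬_; Dec; does; yes; no)
open import Relation.Nullary.Decidable using (dec-true; dec-false; dec⇒maybe)
open import Algebra.Properties.Ring +-*-ring using (x[y-z]≈xy-xz; [y-z]x≈yx-zx)
open import Tactic.RingSolver using (solve-∀)
open import Tactic.RingSolver.Core.AlmostCommutativeRing
  using (AlmostCommutativeRing; fromCommutativeRing)
open import Algebra.Properties.Semiring.Sum (CommutativeRing.semiring +-*-commutativeRing)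
  using (sum; sum-cong-≗; ∑-distrib-+; ∑-comm; *-distribˡ-sum; *-distribʳ-sum; sum-replicate-zero)

ringℚ : AlmostCommutativeRing _ _
ringℚ = fromCommutativeRing +-*-commutativeRing (λ x → dec⇒maybe (0ℚ ≟ℚ x))

2ℚ : ℚ
2ℚ = + 2 / 1

+-cancelʳ-≤ : ∀ {p q} r → p + r ≤ q + r → p ≤ q
+-cancelʳ-≤ {p} {q} r p+r≤q+r =
  subst₂ _≤_ (x+r-r≡x p r) (x+r-r≡x q r) (+-monoˡ-≤ (- r) p+r≤q+r)
  where
  x+r-r≡x : ∀ x r → (x + r) - r ≡ x
  x+r-r≡x = solve-∀ ringℚ

0≤q-p⇒p≤q : ∀ {p q} → 0ℚ ≤ q - p → p ≤ q
0≤q-p⇒p≤q {p} {q} 0≤q-p = subst₂ _≤_ (+-identityˡ p) (q-p+p≡q q p) (+-monoˡ-≤ p 0≤q-p)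
  where
  q-p+p≡q : ∀ q p → (q - p) + p ≡ q
  q-p+p≡q = solve-∀ ringℚ

square-nonNeg : ∀ x → 0ℚ ≤ x * x
square-nonNeg x with ≤-total 0ℚ x
... | inj₁ 0≤x = nonNegative⁻¹ (x * x) {{nonNeg*nonNeg⇒nonNeg x {{nonNegative 0≤x}} x {{nonNegative 0≤x}}}}
... | inj₂ x≤0 = nonNegative⁻¹ (x * x) {{nonPos*nonPos⇒nonPos x {{nonPositive x≤0}} x {{nonPositive x≤0}}}}

*-preserves-0≤ : ∀ {p q} → 0ℚ ≤ p → 0ℚ ≤ q → 0ℚ ≤ p * q
*-preserves-0≤ {p} {q} 0≤p 0≤q =
  nonNegative⁻¹ (p * q) {{nonNeg*nonNeg⇒nonNeg p {{nonNegative 0≤p}} q {{nonNegative 0≤q}}}}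

0≤x+x⇒0≤x : ∀ {x} → 0ℚ ≤ x + x → 0ℚ ≤ x
0≤x+x⇒0≤x {x} 0≤x+x = *-cancelˡ-≤-pos 2ℚ (subst₂ _≤_ (sym (*-zeroʳ 2ℚ)) (x+x≡2x x) 0≤x+x)
  where
  x+x≡2x : ∀ x → x + x ≡ 2ℚ * x
  x+x≡2x = solve-∀ ringℚ

toℚᵘ-/ : ∀ i d → toℚᵘ (i / suc d) ℚᵘ.≃ ℚᵘ.mkℚᵘ i d
toℚᵘ-/ i d = toℚᵘ-fromℚᵘ (ℚᵘ.mkℚᵘ i d)

suc/1≡1+n/1 : ∀ n → + suc n / 1 ≡ 1ℚ + + n / 1
suc/1≡1+n/1 n = toℚᵘ-injective (begin
  toℚᵘ (+ suc n / 1)                  ≈⟨ toℚᵘ-/ (+ suc n) 0 ⟩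
  ℚᵘ.mkℚᵘ (+ suc n) 0                 ≈⟨ ℚᵘ.*≡* (ℤ-identity (+ n)) ⟩
  ℚᵘ.1ℚᵘ ℚᵘ.+ ℚᵘ.mkℚᵘ (+ n) 0          ≈⟨ ℚᵘ.+-congʳ ℚᵘ.1ℚᵘ (ℚᵘ.≃-sym (toℚᵘ-/ (+ n) 0)) ⟩
  toℚᵘ 1ℚ ℚᵘ.+ toℚᵘ (+ n / 1)         ≈⟨ ℚᵘ.≃-sym (toℚᵘ-homo-+ 1ℚ (+ n / 1)) ⟩
  toℚᵘ (1ℚ + + n / 1)                 ∎)
  where
  open ℚᵘ.≃-Reasoning
  ℤ-identity : ∀ k → (+ 1 ℤ.+ k) ℤ.* (+ 1 ℤ.* + 1) ≡ (+ 1 ℤ.* + 1 ℤ.+ k ℤ.* + 1) ℤ.* + 1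
  ℤ-identity = ℤ.solve-∀

suc/1-1≡n/1 : ∀ n → + suc n / 1 - 1ℚ ≡ + n / 1
suc/1-1≡n/1 n = trans (cong (_- 1ℚ) (suc/1≡1+n/1 n)) (1+x-1≡x (+ n / 1))
  where
  1+x-1≡x : ∀ x → (1ℚ + x) - 1ℚ ≡ x
  1+x-1≡x = solve-∀ ringℚ

i/n*n≡i : ∀ i n .{{_ : NonZero n}} → (i / n) * (+ n / 1) ≡ i / 1
i/n*n≡i i (suc d) = toℚᵘ-injective (begin
  toℚᵘ ((i / suc d) * (+ suc d / 1))                ≈⟨ toℚᵘ-homo-* (i / suc d) (+ suc d / 1) ⟩
  toℚᵘ (i / suc d) ℚᵘ.* toℚᵘ (+ suc d / 1)          ≈⟨ ℚᵘ.*-cong (toℚᵘ-/ i d) (toℚᵘ-/ (+ suc d) 0) ⟩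
  ℚᵘ.mkℚᵘ i d ℚᵘ.* ℚᵘ.mkℚᵘ (+ suc d) 0             ≈⟨ ℚᵘ.*≡* (ℤ-identity i (+ suc d)) ⟩
  ℚᵘ.mkℚᵘ i 0                                      ≈⟨ ℚᵘ.≃-sym (toℚᵘ-/ i 0) ⟩
  toℚᵘ (i / 1)                                     ∎)
  where
  open ℚᵘ.≃-Reasoning
  ℤ-identity : ∀ i k → (i ℤ.* k) ℤ.* + 1 ≡ i ℤ.* (k ℤ.* + 1)
  ℤ-identity = ℤ.solve-∀

Σ≡sum : ∀ {n} (f : Vector n) → Σ[ n ] f ≡ sum f
Σ≡sum {zero}  f = refl
Σ≡sum {suc n} f = cong (_+_ (f zero)) (Σ≡sum (f ∘ suc))

Σ-comm : ∀ {m n} (f : Fin m → Fin n → ℚ) →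
         Σ[ m ] (λ i → Σ[ n ] (f i)) ≡ Σ[ n ] (λ j → Σ[ m ] (λ i → f i j))
Σ-comm f = trans (Σ²≡sum² f) (trans (∑-comm f) (sym (Σ²≡sum² (flip f))))
  where
  Σ²≡sum² : ∀ {m n} (g : Fin m → Fin n → ℚ) →
            Σ[ m ] (λ i → Σ[ n ] (g i)) ≡ sum (λ i → sum (g i))
  Σ²≡sum² {m} {n} g = trans (Σ≡sum (λ i → Σ[ n ] (g i))) (sum-cong-≗ (λ i → Σ≡sum (g i)))

module _ {n : ℕ} where

  Σ-cong : {f g : Vector n} → (∀ i → f i ≡ g i) → Σ[ n ] f ≡ Σ[ n ] g
  Σ-cong {f} {g} f≗g rewrite Σ≡sum f | Σ≡sum g = sum-cong-≗ f≗g

  Σ-distrib-+ : (f g : Vector n) → Σ[ n ] (λ i → f i + g i) ≡ Σ[ n ] f + Σ[ n ] g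
  Σ-distrib-+ f g rewrite Σ≡sum (λ i → f i + g i) | Σ≡sum f | Σ≡sum g = ∑-distrib-+ f g

  *-distribˡ-Σ : (c : ℚ) (f : Vector n) → c * Σ[ n ] f ≡ Σ[ n ] (λ i → c * f i)
  *-distribˡ-Σ c f rewrite Σ≡sum f | Σ≡sum (λ i → c * f i) = *-distribˡ-sum c f

  *-distribʳ-Σ : (c : ℚ) (f : Vector n) → Σ[ n ] f * c ≡ Σ[ n ] (λ i → f i * c)
  *-distribʳ-Σ c f rewrite Σ≡sum f | Σ≡sum (λ i → f i * c) = *-distribʳ-sum c f

  Σ-zero : Σ[ n ] (λ _ → 0ℚ) ≡ 0ℚ
  Σ-zero rewrite Σ≡sum {n} (λ _ → 0ℚ) = sum-replicate-zero n

Σ-neg : ∀ {n} (f : Vector n) → Σ[ n ] (λ i → - f i) ≡ - Σ[ n ] f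
Σ-neg {zero}  f = refl
Σ-neg {suc n} f = trans (cong (_+_ (- f zero)) (Σ-neg (f ∘ suc))) (sym (neg-distrib-+ (f zero) (Σ[ n ] (f ∘ suc))))

Σ-distrib-sub : ∀ {n} (f g : Vector n) → Σ[ n ] (λ i → f i - g i) ≡ Σ[ n ] f - Σ[ n ] g
Σ-distrib-sub f g = trans (Σ-distrib-+ f (λ i → - g i)) (cong (_+_ (Σ[ _ ] f)) (Σ-neg g))

Σ-mono-≤ : ∀ {n} {f g : Vector n} → (∀ i → f i ≤ g i) → Σ[ n ] f ≤ Σ[ n ] g
Σ-mono-≤ {zero}  f≤g = ≤-refl
Σ-mono-≤ {suc n} f≤g = +-mono-≤ (f≤g zero) (Σ-mono-≤ (f≤g ∘ suc))

Σ-nonNeg : ∀ {n} {f : Vector n} → (∀ i → 0ℚ ≤ f i) → 0ℚ ≤ Σ[ n ] f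
Σ-nonNeg {n} {f} 0≤f = subst (_≤ Σ[ n ] f) (Σ-zero {n}) (Σ-mono-≤ 0≤f)

0≤n/1-1 : ∀ n .{{_ : NonZero n}} → 0ℚ ≤ + n / 1 - 1ℚ
0≤n/1-1 (suc k) = subst (0ℚ ≤_) (sym (suc/1-1≡n/1 k)) (nonNegative⁻¹ (+ k / 1) {{normalize-nonNeg k 1}})

Σ-const : ∀ {n} (c : ℚ) → Σ[ n ] (λ _ → c) ≡ (+ n / 1) * c
Σ-const {zero}  c = sym (*-zeroˡ c)
Σ-const {suc n} c = begin
  c + Σ[ n ] (λ _ → c)        ≡⟨ cong (_+_ c) (Σ-const {n} c) ⟩
  c + (+ n / 1) * c           ≡⟨ one+x*c (+ n / 1) c ⟩
  (1ℚ + + n / 1) * c          ≡⟨ cong (_* c) (sym (suc/1≡1+n/1 n)) ⟩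
  (+ suc n / 1) * c           ∎
  where
  open ≡-Reasoning
  one+x*c : ∀ x c → c + x * c ≡ (1ℚ + x) * c
  one+x*c = solve-∀ ringℚ

module _ {n : ℕ} {A : Set} (x y : A) where

  if-≟-refl : (i : Fin n) → (if does (i ≟ i) then x else y) ≡ x
  if-≟-refl i = cong (λ b → if b then x else y) (dec-true (i ≟ i) refl)

  if-≟-≢ : {i j : Fin n} → ¬ i ≡ j → (if does (i ≟ j) then x else y) ≡ y
  if-≟-≢ {i} {j} i≢j = cong (λ b → if b then x else y) (dec-false (i ≟ j) i≢j)

Σ-select : ∀ {n} (i : Fin n) (f : Vector n) → Σ[ n ] (λ k → idMatrix n i k * f k) ≡ f i
Σ-select {suc n} zero f = begin
  1ℚ * f zero + Σ[ n ] (λ k → 0ℚ * f (suc k))  ≡⟨ cong₂ _+_ (*-identityˡ (f zero)) (Σ-cong (λ k → *-zeroˡ (f (suc k)))) ⟩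
  f zero + Σ[ n ] (λ _ → 0ℚ)                    ≡⟨ cong (_+_ (f zero)) (Σ-zero {n}) ⟩
  f zero + 0ℚ                                   ≡⟨ +-identityʳ (f zero) ⟩
  f zero                                        ∎
  where open ≡-Reasoning
Σ-select {suc n} (suc i) f =
  trans (cong₂ _+_ (*-zeroˡ (f zero)) (Σ-select i (f ∘ suc))) (+-identityˡ (f (suc i)))

Symmetric : ∀ {n} → Matrix n → Set
Symmetric P = ∀ i j → P i j ≡ P j i

module _ {n : ℕ} where

  infixl 6 _-ᵥ_
  infixr 7 _*ᵥ_
  infix 7 _·_

  _-ᵥ_ : Vector n → Vector n → Vector n
  (a -ᵥ b) i = a i - b i

  _*ᵥ_ : ℚ → Vector n → Vector n
  (c *ᵥ a) i = c * a i

  _·_ : Vector n → Vector n → ℚ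
  a · b = Σ[ n ] (λ i → a i * b i)

  ⟨_∣_∣_⟩ : Vector n → Matrix n → Vector n → ℚ
  ⟨ a ∣ P ∣ b ⟩ = a · matVec P b

  e : Fin n → Vector n
  e = idMatrix n

  1ᵥ : Vector n
  1ᵥ _ = 1ℚ

  ·-congʳ : ∀ a {b c} → (∀ i → b i ≡ c i) → a · b ≡ a · c
  ·-congʳ a b≗c = Σ-cong (λ i → cong (_*_ (a i)) (b≗c i))

  ·-sub-left : ∀ a b c → (a -ᵥ b) · c ≡ a · c - b · c
  ·-sub-left a b c = trans (Σ-cong (λ i → [y-z]x≈yx-zx (c i) (a i) (b i)))
                           (Σ-distrib-sub (λ i → a i * c i) (λ i → b i * c i))

  ·-sub-right : ∀ a b c → a · (b -ᵥ c) ≡ a · b - a · c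
  ·-sub-right a b c = trans (Σ-cong (λ i → x[y-z]≈xy-xz (a i) (b i) (c i)))
                            (Σ-distrib-sub (λ i → a i * b i) (λ i → a i * c i))

  ·-scale-left : ∀ c a b → (c *ᵥ a) · b ≡ c * (a · b)
  ·-scale-left c a b = trans (Σ-cong (λ i → *-assoc c (a i) (b i))) (sym (*-distribˡ-Σ c (λ i → a i * b i)))

  ·-scale-right : ∀ c a b → a · (c *ᵥ b) ≡ c * (a · b)
  ·-scale-right c a b = trans (Σ-cong (λ i → x*[c*y]≡c*[x*y] (a i) c (b i))) (sym (*-distribˡ-Σ c (λ i → a i * b i)))
    where
    x*[c*y]≡c*[x*y] : ∀ x c y → x * (c * y) ≡ c * (x * y)
    x*[c*y]≡c*[x*y] = solve-∀ ringℚ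

  ·-comm : ∀ a b → a · b ≡ b · a
  ·-comm a b = Σ-cong (λ i → *-comm (a i) (b i))

  matVec-sub : ∀ P a b i → matVec P (a -ᵥ b) i ≡ matVec P a i - matVec P b i
  matVec-sub P a b i = ·-sub-right (P i) a b

  matVec-scale : ∀ P c a i → matVec P (c *ᵥ a) i ≡ c * matVec P a i
  matVec-scale P c a i = ·-scale-right c (P i) a

  ⟨⟩-sub-right : ∀ a P b c → ⟨ a ∣ P ∣ b -ᵥ c ⟩ ≡ ⟨ a ∣ P ∣ b ⟩ - ⟨ a ∣ P ∣ c ⟩
  ⟨⟩-sub-right a P b c = trans (·-congʳ a (matVec-sub P b c)) (·-sub-right a _ _)

  ⟨⟩-scale-right : ∀ a P c b → ⟨ a ∣ P ∣ c *ᵥ b ⟩ ≡ c * ⟨ a ∣ P ∣ b ⟩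
  ⟨⟩-scale-right a P c b = trans (·-congʳ a (matVec-scale P c b)) (·-scale-right c a _)

  ⟨⟩-basis : ∀ P i j → ⟨ e i ∣ P ∣ e j ⟩ ≡ P i j
  ⟨⟩-basis P i j = trans (Σ-select i _) (trans (·-comm (P i) (e j)) (Σ-select j (P i)))

  ⟨⟩-id : ∀ a b → ⟨ a ∣ idMatrix n ∣ b ⟩ ≡ a · b
  ⟨⟩-id a b = ·-congʳ a (λ i → Σ-select i b)

  ⟨⟩-sym : ∀ {P} → Symmetric P → ∀ a b → ⟨ a ∣ P ∣ b ⟩ ≡ ⟨ b ∣ P ∣ a ⟩
  ⟨⟩-sym {P} P-sym a b = begin
    Σ[ n ] (λ i → a i * Σ[ n ] (λ j → P i j * b j))  ≡⟨ Σ-cong (λ i → *-distribˡ-Σ (a i) (λ j → P i j * b j)) ⟩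
    Σ[ n ] (λ i → Σ[ n ] (λ j → a i * (P i j * b j))) ≡⟨ Σ-comm (λ i j → a i * (P i j * b j)) ⟩
    Σ[ n ] (λ j → Σ[ n ] (λ i → a i * (P i j * b j))) ≡⟨ Σ-cong (λ j → Σ-cong (λ i → trans (cong (λ p → a i * (p * b j)) (P-sym i j))
                                                                                      (x*[p*y]≡y*[p*x] (a i) (P j i) (b j)))) ⟩
    Σ[ n ] (λ j → Σ[ n ] (λ i → b j * (P j i * a i))) ≡⟨ Σ-cong (λ j → sym (*-distribˡ-Σ (b j) (λ i → P j i * a i))) ⟩
    Σ[ n ] (λ j → b j * Σ[ n ] (λ i → P j i * a i))  ∎
    where
    open ≡-Reasoning
    x*[p*y]≡y*[p*x] : ∀ x p y → x * (p * y) ≡ y * (p * x)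
    x*[p*y]≡y*[p*x] = solve-∀ ringℚ

  ⟨⟩-ones : ∀ P → ⟨ 1ᵥ ∣ P ∣ 1ᵥ ⟩ ≡ Σ[ n ] (λ i → Σ[ n ] (P i))
  ⟨⟩-ones P = Σ-cong (λ i → trans (*-identityˡ (matVec P 1ᵥ i)) (Σ-cong (λ j → *-identityʳ (P i j))))

  ⟨⟩-diff : ∀ P i j → ⟨ e i -ᵥ e j ∣ P ∣ e i -ᵥ e j ⟩ ≡ (P i i - P i j) - (P j i - P j j)
  ⟨⟩-diff P i j = begin
    ⟨ e i -ᵥ e j ∣ P ∣ e i -ᵥ e j ⟩
      ≡⟨ ·-sub-left (e i) (e j) _ ⟩
    ⟨ e i ∣ P ∣ e i -ᵥ e j ⟩ - ⟨ e j ∣ P ∣ e i -ᵥ e j ⟩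
      ≡⟨ cong₂ _-_ (⟨⟩-sub-right (e i) P (e i) (e j)) (⟨⟩-sub-right (e j) P (e i) (e j)) ⟩
    (⟨ e i ∣ P ∣ e i ⟩ - ⟨ e i ∣ P ∣ e j ⟩) - (⟨ e j ∣ P ∣ e i ⟩ - ⟨ e j ∣ P ∣ e j ⟩)
      ≡⟨ cong₂ _-_ (cong₂ _-_ (⟨⟩-basis P i i) (⟨⟩-basis P i j)) (cong₂ _-_ (⟨⟩-basis P j i) (⟨⟩-basis P j j)) ⟩
    (P i i - P i j) - (P j i - P j j) ∎
    where open ≡-Reasoning

laplacianForm : ∀ {n} → Matrix n → Vector n → ℚ
laplacianForm {n} A w = Σ[ n ] (λ i → w i * Σ[ n ] (λ j → A i j * (w i - w j)))

-- Symmetrising the double sum turns 2 wᵀ L w into Σᵢⱼ Aᵢⱼ (wᵢ - wⱼ)².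
laplacianForm-nonNeg : ∀ {n} {A : Matrix n} → Symmetric A → (∀ i j → 0ℚ ≤ A i j) →
                       ∀ w → 0ℚ ≤ laplacianForm A w
laplacianForm-nonNeg {n} {A} A-sym 0≤A w = 0≤x+x⇒0≤x (subst (0ℚ ≤_) (sym L+L≡energy)
  (Σ-nonNeg (λ i → Σ-nonNeg (λ j → *-preserves-0≤ (0≤A i j) (square-nonNeg (w i - w j))))))
  where
  t : Fin n → Fin n → ℚ
  t i j = w i * (A i j * (w i - w j))
  L : ℚ
  L = laplacianForm A w
  pair : ∀ a wᵢ wⱼ → wᵢ * (a * (wᵢ - wⱼ)) + wⱼ * (a * (wⱼ - wᵢ)) ≡ a * ((wᵢ - wⱼ) * (wᵢ - wⱼ))
  pair = solve-∀ ringℚ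
  L+L≡energy : L + L ≡ Σ[ n ] (λ i → Σ[ n ] (λ j → A i j * ((w i - w j) * (w i - w j))))
  L+L≡energy = begin
    L + L                                                ≡⟨ cong₂ _+_ L≡ΣΣt (trans L≡ΣΣt (Σ-comm t)) ⟩
    Σ[ n ] (λ i → Σ[ n ] (t i)) + Σ[ n ] (λ i → Σ[ n ] (λ j → t j i))
                                                         ≡⟨ sym (Σ-distrib-+ (λ i → Σ[ n ] (t i)) (λ i → Σ[ n ] (λ j → t j i))) ⟩
    Σ[ n ] (λ i → Σ[ n ] (t i) + Σ[ n ] (λ j → t j i))   ≡⟨ Σ-cong (λ i → sym (Σ-distrib-+ (t i) (λ j → t j i))) ⟩
    Σ[ n ] (λ i → Σ[ n ] (λ j → t i j + t j i))          ≡⟨ Σ-cong (λ i → Σ-cong (λ j →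
                                                              trans (cong (λ a → t i j + w j * (a * (w j - w i))) (A-sym j i))
                                                                    (pair (A i j) (w i) (w j)))) ⟩
    Σ[ n ] (λ i → Σ[ n ] (λ j → A i j * ((w i - w j) * (w i - w j)))) ∎
    where
    open ≡-Reasoning
    L≡ΣΣt : L ≡ Σ[ n ] (λ i → Σ[ n ] (t i))
    L≡ΣΣt = Σ-cong (λ i → *-distribˡ-Σ (w i) (λ j → A i j * (w i - w j)))

Σ-offDiagonal : ∀ {n} (i : Fin n) → Σ[ n ] (λ j → 1ℚ - idMatrix n i j) ≡ + n / 1 - 1ℚ
Σ-offDiagonal {n} i = trans (Σ-distrib-sub (λ _ → 1ℚ) (e i))
  (cong₂ _-_ (trans (Σ-const {n} 1ℚ) (*-identityʳ (+ n / 1)))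
             (trans (Σ-cong (λ j → sym (*-identityʳ (e i j)))) (Σ-select i (λ _ → 1ℚ))))

b2ℚ-nonNeg : ∀ b → 0ℚ ≤ b2ℚ b
b2ℚ-nonNeg true  = nonNegative⁻¹ 1ℚ
b2ℚ-nonNeg false = ≤-refl

b2ℚ≤1 : ∀ b → b2ℚ b ≤ 1ℚ
b2ℚ≤1 true  = ≤-refl
b2ℚ≤1 false = nonNegative⁻¹ 1ℚ

-- The matrix Γ of a graph
module _ {n : ℕ} {{_ : NonZero n}} (G : SimpleGraph n) where

  private
    A : Matrix n
    A = adjMatrix G
    Γ : Matrix n
    Γ = Gamma G
    n⁻¹ : ℚ
    n⁻¹ = + 1 / n

  adjMatrix-sym : Symmetric A
  adjMatrix-sym i j = cong b2ℚ (symm G i j)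

  adjMatrix-nonNeg : ∀ i j → 0ℚ ≤ A i j
  adjMatrix-nonNeg i j = b2ℚ-nonNeg (adj G i j)

  adjMatrix-diag : ∀ i → A i i ≡ 0ℚ
  adjMatrix-diag i = cong b2ℚ (irrefl G i)

  adjMatrix≤offDiagonal : ∀ i j → A i j ≤ 1ℚ - idMatrix n i j
  adjMatrix≤offDiagonal i j with i ≟ j
  ... | yes refl = ≤-reflexive (adjMatrix-diag i)
  ... | no _     = b2ℚ≤1 (adj G i j)

  degree≤n-1 : ∀ i → degree G i ≤ + n / 1 - 1ℚ
  degree≤n-1 i = subst (degree G i ≤_) (Σ-offDiagonal i) (Σ-mono-≤ (adjMatrix≤offDiagonal i))

  degMatrix≡δ*degree : ∀ i j → degMatrix G i j ≡ idMatrix n i j * degree G i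
  degMatrix≡δ*degree i j with does (i ≟ j)
  ... | true  = sym (*-identityˡ (degree G i))
  ... | false = sym (*-zeroˡ (degree G i))

  Gamma-diag : ∀ i → Γ i i ≡ degree G i + n⁻¹
  Gamma-diag i = begin
    (degMatrix G i i - A i i) + n⁻¹  ≡⟨ cong₂ (λ x y → (x - y) + n⁻¹) (if-≟-refl (degree G i) 0ℚ i) (adjMatrix-diag i) ⟩
    (degree G i - 0ℚ) + n⁻¹          ≡⟨ cong (_+ n⁻¹) (+-identityʳ (degree G i)) ⟩
    degree G i + n⁻¹                 ∎
    where open ≡-Reasoning

  Gamma-off : ∀ {i j} → ¬ i ≡ j → Γ i j ≡ n⁻¹ - A i j
  Gamma-off {i} {j} i≢j = trans (cong (λ x → (x - A i j) + n⁻¹) (if-≟-≢ (degree G i) 0ℚ i≢j))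
                                (0-a+t≡t-a (A i j) n⁻¹)
    where
    0-a+t≡t-a : ∀ a t → (0ℚ - a) + t ≡ t - a
    0-a+t≡t-a = solve-∀ ringℚ

  Gamma-sym : Symmetric Γ
  Gamma-sym i j = by-cases (i ≟ j)
    where
    by-cases : Dec (i ≡ j) → Γ i j ≡ Γ j i
    by-cases (yes refl) = refl
    by-cases (no i≢j)   = trans (Gamma-off i≢j)
      (trans (cong (_-_ n⁻¹) (adjMatrix-sym i j)) (sym (Gamma-off (i≢j ∘ sym))))

  matVec-Gamma : ∀ w i → matVec Γ w i ≡ Σ[ n ] (λ j → A i j * (w i - w j)) + n⁻¹ * Σ[ n ] w
  matVec-Gamma w i = begin
    Σ[ n ] (λ j → ((degMatrix G i j - A i j) + n⁻¹) * w j)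
      ≡⟨ Σ-cong (λ j → expand (degMatrix G i j) (A i j) n⁻¹ (w j)) ⟩
    Σ[ n ] (λ j → (degMatrix G i j * w j - A i j * w j) + n⁻¹ * w j)
      ≡⟨ Σ-distrib-+ (λ j → degMatrix G i j * w j - A i j * w j) (λ j → n⁻¹ * w j) ⟩
    Σ[ n ] (λ j → degMatrix G i j * w j - A i j * w j) + Σ[ n ] (λ j → n⁻¹ * w j)
      ≡⟨ cong₂ _+_ (Σ-distrib-sub (λ j → degMatrix G i j * w j) (λ j → A i j * w j))
                   (sym (*-distribˡ-Σ n⁻¹ w)) ⟩
    (Σ[ n ] (λ j → degMatrix G i j * w j) - Σ[ n ] (λ j → A i j * w j)) + n⁻¹ * Σ[ n ] w
      ≡⟨ cong (λ x → (x - Σ[ n ] (λ j → A i j * w j)) + n⁻¹ * Σ[ n ] w) degree-part ⟩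
    (Σ[ n ] (λ j → A i j * w i) - Σ[ n ] (λ j → A i j * w j)) + n⁻¹ * Σ[ n ] w
      ≡⟨ cong (_+ n⁻¹ * Σ[ n ] w) (sym (Σ-distrib-sub (λ j → A i j * w i) (λ j → A i j * w j))) ⟩
    Σ[ n ] (λ j → A i j * w i - A i j * w j) + n⁻¹ * Σ[ n ] w
      ≡⟨ cong (_+ n⁻¹ * Σ[ n ] w) (Σ-cong (λ j → sym (x[y-z]≈xy-xz (A i j) (w i) (w j)))) ⟩
    Σ[ n ] (λ j → A i j * (w i - w j)) + n⁻¹ * Σ[ n ] w ∎
    where
    open ≡-Reasoning
    expand : ∀ d a t w → ((d - a) + t) * w ≡ (d * w - a * w) + t * w
    expand = solve-∀ ringℚ
    degree-part : Σ[ n ] (λ j → degMatrix G i j * w j) ≡ Σ[ n ] (λ j → A i j * w i)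
    degree-part = begin
      Σ[ n ] (λ j → degMatrix G i j * w j)          ≡⟨ Σ-cong (λ j → trans (cong (_* w j) (degMatrix≡δ*degree i j))
                                                                          (*-assoc (e i j) (degree G i) (w j))) ⟩
      Σ[ n ] (λ j → e i j * (degree G i * w j))     ≡⟨ Σ-select i (λ j → degree G i * w j) ⟩
      degree G i * w i                              ≡⟨ *-distribʳ-Σ (w i) (A i) ⟩
      Σ[ n ] (λ j → A i j * w i)                    ∎

  ⟨⟩-Gamma : ∀ w → ⟨ w ∣ Γ ∣ w ⟩ ≡ laplacianForm A w + n⁻¹ * (Σ[ n ] w * Σ[ n ] w)
  ⟨⟩-Gamma w = begin
    Σ[ n ] (λ i → w i * matVec Γ w i)
      ≡⟨ Σ-cong (λ i → trans (cong (_*_ (w i)) (matVec-Gamma w i)) (*-distribˡ-+ (w i) _ (n⁻¹ * W))) ⟩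
    Σ[ n ] (λ i → w i * Σ[ n ] (λ j → A i j * (w i - w j)) + w i * (n⁻¹ * W))
      ≡⟨ Σ-distrib-+ (λ i → w i * Σ[ n ] (λ j → A i j * (w i - w j))) (λ i → w i * (n⁻¹ * W)) ⟩
    laplacianForm A w + Σ[ n ] (λ i → w i * (n⁻¹ * W))
      ≡⟨ cong (_+_ (laplacianForm A w)) (trans (sym (*-distribʳ-Σ (n⁻¹ * W) w)) (x*[t*x]≡t*[x*x] W n⁻¹)) ⟩
    laplacianForm A w + n⁻¹ * (W * W) ∎
    where
    open ≡-Reasoning
    W : ℚ
    W = Σ[ n ] w
    x*[t*x]≡t*[x*x] : ∀ x t → x * (t * x) ≡ t * (x * x)
    x*[t*x]≡t*[x*x] = solve-∀ ringℚ

  Gamma-psd : ∀ w → 0ℚ ≤ ⟨ w ∣ Γ ∣ w ⟩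
  Gamma-psd w = subst (0ℚ ≤_) (sym (⟨⟩-Gamma w))
    (+-mono-≤ {0ℚ} {laplacianForm A w} {0ℚ} (laplacianForm-nonNeg adjMatrix-sym adjMatrix-nonNeg w)
      (*-preserves-0≤ (nonNegative⁻¹ n⁻¹ {{normalize-nonNeg 1 n}}) (square-nonNeg (Σ[ n ] w))))

-- Resistance matrices
module _ {n : ℕ} (M : Matrix n) where

  resistance-diag : ∀ i → resistance M i i ≡ 0ℚ
  resistance-diag i = a+a-2a≡0 (M i i)
    where
    a+a-2a≡0 : ∀ a → (a + a) - 2ℚ * a ≡ 0ℚ
    a+a-2a≡0 = solve-∀ ringℚ

  matVec-resistance : ∀ x i → matVec (resistance M) x i
                            ≡ (M i i * Σ[ n ] x + Σ[ n ] (λ j → M j j * x j)) - 2ℚ * matVec M x i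
  matVec-resistance x i = begin
    Σ[ n ] (λ j → ((M i i + M j j) - 2ℚ * M i j) * x j)
      ≡⟨ Σ-cong (λ j → expand (M i i) (M j j) (M i j) (x j)) ⟩
    Σ[ n ] (λ j → (M i i * x j + M j j * x j) - 2ℚ * (M i j * x j))
      ≡⟨ Σ-distrib-sub (λ j → M i i * x j + M j j * x j) (λ j → 2ℚ * (M i j * x j)) ⟩
    Σ[ n ] (λ j → M i i * x j + M j j * x j) - Σ[ n ] (λ j → 2ℚ * (M i j * x j))
      ≡⟨ cong₂ _-_ (trans (Σ-distrib-+ (λ j → M i i * x j) (λ j → M j j * x j))
                          (cong (_+ Σ[ n ] (λ j → M j j * x j)) (sym (*-distribˡ-Σ (M i i) x))))
                   (sym (*-distribˡ-Σ 2ℚ (λ j → M i j * x j))) ⟩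
    (M i i * Σ[ n ] x + Σ[ n ] (λ j → M j j * x j)) - 2ℚ * matVec M x i ∎
    where
    open ≡-Reasoning
    expand : ∀ a b c y → ((a + b) - 2ℚ * c) * y ≡ (a * y + b * y) - 2ℚ * (c * y)
    expand = solve-∀ ringℚ

  ⟨⟩-resistance-zeroSum : ∀ x → Σ[ n ] x ≡ 0ℚ → ⟨ x ∣ resistance M ∣ x ⟩ ≡ - (2ℚ * ⟨ x ∣ M ∣ x ⟩)
  ⟨⟩-resistance-zeroSum x Σx≡0 = begin
    Σ[ n ] (λ i → x i * matVec (resistance M) x i)
      ≡⟨ Σ-cong (λ i → trans (cong (_*_ (x i)) (matVec-resistance x i))
                             (cong (λ s → x i * ((M i i * s + C) - 2ℚ * matVec M x i)) Σx≡0)) ⟩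
    Σ[ n ] (λ i → x i * ((M i i * 0ℚ + C) - 2ℚ * matVec M x i))
      ≡⟨ Σ-cong (λ i → expand (x i) (M i i) C (matVec M x i)) ⟩
    Σ[ n ] (λ i → C * x i - 2ℚ * (x i * matVec M x i))
      ≡⟨ Σ-distrib-sub (λ i → C * x i) (λ i → 2ℚ * (x i * matVec M x i)) ⟩
    Σ[ n ] (λ i → C * x i) - Σ[ n ] (λ i → 2ℚ * (x i * matVec M x i))
      ≡⟨ cong₂ _-_ (trans (sym (*-distribˡ-Σ C x)) (trans (cong (_*_ C) Σx≡0) (*-zeroʳ C)))
                   (sym (*-distribˡ-Σ 2ℚ (λ i → x i * matVec M x i))) ⟩
    0ℚ - 2ℚ * ⟨ x ∣ M ∣ x ⟩
      ≡⟨ +-identityˡ (- (2ℚ * ⟨ x ∣ M ∣ x ⟩)) ⟩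
    - (2ℚ * ⟨ x ∣ M ∣ x ⟩) ∎
    where
    open ≡-Reasoning
    C : ℚ
    C = Σ[ n ] (λ j → M j j * x j)
    expand : ∀ y a c m → y * ((a * 0ℚ + c) - 2ℚ * m) ≡ c * y - 2ℚ * (y * m)
    expand = solve-∀ ringℚ

-- Inverses of symmetric positive semidefinite matrices
module _ {n : ℕ} {Γ M : Matrix n} (Γ-sym : Symmetric Γ) (Γ-psd : ∀ w → 0ℚ ≤ ⟨ w ∣ Γ ∣ w ⟩)
         (ΓM≡I : ∀ i j → matMul Γ M i j ≡ idMatrix n i j) where

  matVec-inverse : ∀ x i → matVec Γ (matVec M x) i ≡ x i
  matVec-inverse x i = begin
    Σ[ n ] (λ a → Γ i a * Σ[ n ] (λ k → M a k * x k))    ≡⟨ Σ-cong (λ a → *-distribˡ-Σ (Γ i a) (λ k → M a k * x k)) ⟩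
    Σ[ n ] (λ a → Σ[ n ] (λ k → Γ i a * (M a k * x k)))   ≡⟨ Σ-cong (λ a → Σ-cong (λ k → sym (*-assoc (Γ i a) (M a k) (x k)))) ⟩
    Σ[ n ] (λ a → Σ[ n ] (λ k → (Γ i a * M a k) * x k))   ≡⟨ Σ-comm (λ a k → (Γ i a * M a k) * x k) ⟩
    Σ[ n ] (λ k → Σ[ n ] (λ a → (Γ i a * M a k) * x k))   ≡⟨ Σ-cong (λ k → sym (*-distribʳ-Σ (x k) (λ a → Γ i a * M a k))) ⟩
    Σ[ n ] (λ k → matMul Γ M i k * x k)                   ≡⟨ Σ-cong (λ k → cong (_* x k) (ΓM≡I i k)) ⟩
    Σ[ n ] (λ k → idMatrix n i k * x k)                   ≡⟨ Σ-select i x ⟩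
    x i                                                   ∎
    where open ≡-Reasoning

  ⟨⟩-inverse : ∀ x y → ⟨ x ∣ M ∣ y ⟩ ≡ ⟨ matVec M y ∣ Γ ∣ matVec M x ⟩
  ⟨⟩-inverse x y = trans (·-comm x (matVec M y)) (·-congʳ (matVec M y) (λ i → sym (matVec-inverse x i)))

  inverse-sym : Symmetric M
  inverse-sym i j = begin
    M i j                                   ≡⟨ sym (⟨⟩-basis M i j) ⟩
    ⟨ e i ∣ M ∣ e j ⟩                       ≡⟨ ⟨⟩-inverse (e i) (e j) ⟩
    ⟨ matVec M (e j) ∣ Γ ∣ matVec M (e i) ⟩ ≡⟨ ⟨⟩-sym Γ-sym (matVec M (e j)) (matVec M (e i)) ⟩
    ⟨ matVec M (e i) ∣ Γ ∣ matVec M (e j) ⟩ ≡⟨ sym (⟨⟩-inverse (e j) (e i)) ⟩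
    ⟨ e j ∣ M ∣ e i ⟩                       ≡⟨ ⟨⟩-basis M j i ⟩
    M j i                                   ∎
    where open ≡-Reasoning

  inverse-psd : ∀ x → 0ℚ ≤ ⟨ x ∣ M ∣ x ⟩
  inverse-psd x = subst (0ℚ ≤_) (sym (⟨⟩-inverse x x)) (Γ-psd (matVec M x))

  inverse-variational : ∀ x z → 2ℚ * (z · x) ≤ ⟨ x ∣ M ∣ x ⟩ + ⟨ z ∣ Γ ∣ z ⟩
  inverse-variational x z = 0≤q-p⇒p≤q (subst (0ℚ ≤_) expansion (Γ-psd (u -ᵥ z)))
    where
    u : Vector n
    u = matVec M x
    ⟨z∣Γ∣u⟩≡z·x : ⟨ z ∣ Γ ∣ u ⟩ ≡ z · x
    ⟨z∣Γ∣u⟩≡z·x = ·-congʳ z (matVec-inverse x)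
    rearrange : ∀ r a c → (r - a) - (a - c) ≡ (r + c) - 2ℚ * a
    rearrange = solve-∀ ringℚ
    expansion : ⟨ u -ᵥ z ∣ Γ ∣ u -ᵥ z ⟩ ≡ (⟨ x ∣ M ∣ x ⟩ + ⟨ z ∣ Γ ∣ z ⟩) - 2ℚ * (z · x)
    expansion = begin
      ⟨ u -ᵥ z ∣ Γ ∣ u -ᵥ z ⟩
        ≡⟨ ·-sub-left u z (matVec Γ (u -ᵥ z)) ⟩
      ⟨ u ∣ Γ ∣ u -ᵥ z ⟩ - ⟨ z ∣ Γ ∣ u -ᵥ z ⟩
        ≡⟨ cong₂ _-_ (⟨⟩-sub-right u Γ u z) (⟨⟩-sub-right z Γ u z) ⟩
      (⟨ u ∣ Γ ∣ u ⟩ - ⟨ u ∣ Γ ∣ z ⟩) - (⟨ z ∣ Γ ∣ u ⟩ - ⟨ z ∣ Γ ∣ z ⟩)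
        ≡⟨ cong₂ _-_ (cong₂ _-_ (sym (⟨⟩-inverse x x)) (trans (⟨⟩-sym Γ-sym u z) ⟨z∣Γ∣u⟩≡z·x))
                     (cong (_- ⟨ z ∣ Γ ∣ z ⟩) ⟨z∣Γ∣u⟩≡z·x) ⟩
      (⟨ x ∣ M ∣ x ⟩ - z · x) - (z · x - ⟨ z ∣ Γ ∣ z ⟩)
        ≡⟨ rearrange ⟨ x ∣ M ∣ x ⟩ (z · x) ⟨ z ∣ Γ ∣ z ⟩ ⟩
      (⟨ x ∣ M ∣ x ⟩ + ⟨ z ∣ Γ ∣ z ⟩) - 2ℚ * (z · x) ∎
      where open ≡-Reasoning

-- Effective resistances of a graph
module _ {n : ℕ} {{_ : NonZero n}} (G : SimpleGraph n) {M : Matrix n}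
         (ΓM≡I : ∀ i j → matMul (Gamma G) M i j ≡ idMatrix n i j) where

  private
    Γ : Matrix n
    Γ = Gamma G
    Ω : Matrix n
    Ω = resistance M
    n⁻¹ : ℚ
    n⁻¹ = + 1 / n
    N : ℚ
    N = + n / 1
    n⁻¹*N≡1 : n⁻¹ * N ≡ 1ℚ
    n⁻¹*N≡1 = i/n*n≡i (+ 1) n
    0≤n⁻¹ : 0ℚ ≤ n⁻¹
    0≤n⁻¹ = nonNegative⁻¹ n⁻¹ {{normalize-nonNeg 1 n}}
    M-sym : Symmetric M
    M-sym = inverse-sym (Gamma-sym G) (Gamma-psd G) ΓM≡I

  resistance-sym : Symmetric Ω
  resistance-sym i j = cong₂ _-_ (+-comm (M i i) (M j j)) (cong (_*_ 2ℚ) (M-sym i j))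

  resistance-as-⟨⟩ : ∀ i j → Ω i j ≡ ⟨ e i -ᵥ e j ∣ M ∣ e i -ᵥ e j ⟩
  resistance-as-⟨⟩ i j = begin
    (M i i + M j j) - 2ℚ * M i j        ≡⟨ rearrange (M i i) (M j j) (M i j) ⟩
    (M i i - M i j) - (M i j - M j j)   ≡⟨ cong (λ m → (M i i - M i j) - (m - M j j)) (M-sym i j) ⟩
    (M i i - M i j) - (M j i - M j j)   ≡⟨ sym (⟨⟩-diff M i j) ⟩
    ⟨ e i -ᵥ e j ∣ M ∣ e i -ᵥ e j ⟩     ∎
    where
    open ≡-Reasoning
    rearrange : ∀ a b c → (a + b) - 2ℚ * c ≡ (a - c) - (c - b)
    rearrange = solve-∀ ringℚ

  ⟨⟩-Gamma-diff≤2n : ∀ {i j} → ¬ i ≡ j → ⟨ e i -ᵥ e j ∣ Γ ∣ e i -ᵥ e j ⟩ ≤ 2ℚ * N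
  ⟨⟩-Gamma-diff≤2n {i} {j} i≢j = begin
    ⟨ e i -ᵥ e j ∣ Γ ∣ e i -ᵥ e j ⟩
      ≡⟨ ⟨⟩-diff Γ i j ⟩
    (Γ i i - Γ i j) - (Γ j i - Γ j j)
      ≡⟨ cong₂ _-_ (cong₂ _-_ (Gamma-diag G i) (Gamma-off G i≢j)) (cong₂ _-_ (Gamma-off G (i≢j ∘ sym)) (Gamma-diag G j)) ⟩
    ((d i + n⁻¹) - (n⁻¹ - A i j)) - ((n⁻¹ - A j i) - (d j + n⁻¹))
      ≡⟨ collect (d i) (d j) (A i j) (A j i) n⁻¹ ⟩
    ((d i + d j) + A i j) + A j i
      ≤⟨ +-mono-≤ (+-mono-≤ (+-mono-≤ (degree≤n-1 G i) (degree≤n-1 G j)) (b2ℚ≤1 (adj G i j))) (b2ℚ≤1 (adj G j i)) ⟩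
    (((N - 1ℚ) + (N - 1ℚ)) + 1ℚ) + 1ℚ
      ≡⟨ twice N ⟩
    2ℚ * N ∎
    where
    open ≤-Reasoning
    d : Fin n → ℚ
    d = degree G
    A : Matrix n
    A = adjMatrix G
    collect : ∀ dᵢ dⱼ aᵢⱼ aⱼᵢ t → ((dᵢ + t) - (t - aᵢⱼ)) - ((t - aⱼᵢ) - (dⱼ + t)) ≡ ((dᵢ + dⱼ) + aᵢⱼ) + aⱼᵢ
    collect = solve-∀ ringℚ
    twice : ∀ m → (((m - 1ℚ) + (m - 1ℚ)) + 1ℚ) + 1ℚ ≡ 2ℚ * m
    twice = solve-∀ ringℚ

  -- Test the variational bound with z = (eᵢ - eⱼ) / n.
  resistance≥2/n : ∀ {i j} → ¬ i ≡ j → 2ℚ * n⁻¹ ≤ Ω i j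
  resistance≥2/n {i} {j} i≢j = +-cancelʳ-≤ (2ℚ * n⁻¹) (begin
    2ℚ * n⁻¹ + 2ℚ * n⁻¹                ≡⟨ four n⁻¹ ⟩
    2ℚ * (n⁻¹ * 2ℚ)                    ≡⟨ cong (λ y → 2ℚ * (n⁻¹ * y)) (sym x·x≡2) ⟩
    2ℚ * (n⁻¹ * (x · x))               ≡⟨ cong (_*_ 2ℚ) (sym (·-scale-left n⁻¹ x x)) ⟩
    2ℚ * (z · x)                       ≤⟨ inverse-variational (Gamma-sym G) (Gamma-psd G) ΓM≡I x z ⟩
    ⟨ x ∣ M ∣ x ⟩ + ⟨ z ∣ Γ ∣ z ⟩       ≡⟨ cong₂ _+_ (sym (resistance-as-⟨⟩ i j)) ⟨z∣Γ∣z⟩ ⟩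
    Ω i j + n⁻¹ * (n⁻¹ * q)            ≤⟨ +-monoʳ-≤ (Ω i j) (*-monoˡ-≤-nonNeg n⁻¹ {{nonNegative 0≤n⁻¹}}
                                            (*-monoˡ-≤-nonNeg n⁻¹ {{nonNegative 0≤n⁻¹}} (⟨⟩-Gamma-diff≤2n i≢j))) ⟩
    Ω i j + n⁻¹ * (n⁻¹ * (2ℚ * N))     ≡⟨ cong (_+_ (Ω i j)) (trans (regroup n⁻¹ N) (cong (λ y → (2ℚ * n⁻¹) * y) n⁻¹*N≡1)) ⟩
    Ω i j + (2ℚ * n⁻¹) * 1ℚ            ≡⟨ cong (_+_ (Ω i j)) (*-identityʳ (2ℚ * n⁻¹)) ⟩
    Ω i j + 2ℚ * n⁻¹                   ∎)
    where
    open ≤-Reasoning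
    x : Vector n
    x = e i -ᵥ e j
    z : Vector n
    z = n⁻¹ *ᵥ x
    q : ℚ
    q = ⟨ x ∣ Γ ∣ x ⟩
    x·x≡2 : x · x ≡ 2ℚ
    x·x≡2 = begin-equality
      x · x                                                          ≡⟨ sym (⟨⟩-id x x) ⟩
      ⟨ x ∣ idMatrix n ∣ x ⟩                                           ≡⟨ ⟨⟩-diff (idMatrix n) i j ⟩
      (e i i - e i j) - (e j i - e j j)                              ≡⟨ cong₂ _-_ (cong₂ _-_ (if-≟-refl 1ℚ 0ℚ i) (if-≟-≢ 1ℚ 0ℚ i≢j))
                                                                                  (cong₂ _-_ (if-≟-≢ 1ℚ 0ℚ (i≢j ∘ sym)) (if-≟-refl 1ℚ 0ℚ j)) ⟩
      (1ℚ - 0ℚ) - (0ℚ - 1ℚ)                                          ≡⟨ refl ⟩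
      2ℚ                                                             ∎
    ⟨z∣Γ∣z⟩ : ⟨ z ∣ Γ ∣ z ⟩ ≡ n⁻¹ * (n⁻¹ * q)
    ⟨z∣Γ∣z⟩ = trans (·-scale-left n⁻¹ x (matVec Γ z)) (cong (_*_ n⁻¹) (⟨⟩-scale-right x Γ n⁻¹ x))
    four : ∀ t → 2ℚ * t + 2ℚ * t ≡ 2ℚ * (t * 2ℚ)
    four = solve-∀ ringℚ
    regroup : ∀ t m → t * (t * (2ℚ * m)) ≡ (2ℚ * t) * (t * m)
    regroup = solve-∀ ringℚ

  resistance≥2/n*[1-δ] : ∀ i j → (2ℚ * n⁻¹) * (1ℚ - idMatrix n i j) ≤ Ω i j
  resistance≥2/n*[1-δ] i j = by-cases (i ≟ j)
    where
    by-cases : Dec (i ≡ j) → (2ℚ * n⁻¹) * (1ℚ - idMatrix n i j) ≤ Ω i j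
    by-cases (yes refl) = ≤-reflexive (trans (cong (λ δ → (2ℚ * n⁻¹) * (1ℚ - δ)) (if-≟-refl 1ℚ 0ℚ i))
                                             (trans (*-zeroʳ (2ℚ * n⁻¹)) (sym (resistance-diag M i))))
    by-cases (no i≢j)   = subst (_≤ Ω i j)
      (sym (trans (cong (λ δ → (2ℚ * n⁻¹) * (1ℚ - δ)) (if-≟-≢ 1ℚ 0ℚ i≢j)) (*-identityʳ (2ℚ * n⁻¹))))
      (resistance≥2/n i≢j)

  Σresistance≥2[n-1] : 2ℚ * (N - 1ℚ) ≤ ⟨ 1ᵥ ∣ Ω ∣ 1ᵥ ⟩
  Σresistance≥2[n-1] = begin
    2ℚ * (N - 1ℚ)                                               ≡⟨ sym (*-identityʳ (2ℚ * (N - 1ℚ))) ⟩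
    2ℚ * (N - 1ℚ) * 1ℚ                                          ≡⟨ cong (_*_ (2ℚ * (N - 1ℚ))) (sym n⁻¹*N≡1) ⟩
    2ℚ * (N - 1ℚ) * (n⁻¹ * N)                                   ≡⟨ regroup (N - 1ℚ) n⁻¹ N ⟩
    N * ((2ℚ * n⁻¹) * (N - 1ℚ))                                 ≡⟨ sym (Σ-const {n} ((2ℚ * n⁻¹) * (N - 1ℚ))) ⟩
    Σ[ n ] (λ _ → (2ℚ * n⁻¹) * (N - 1ℚ))                        ≡⟨ Σ-cong {n} (λ i → cong (_*_ (2ℚ * n⁻¹)) (sym (Σ-offDiagonal i))) ⟩
    Σ[ n ] (λ i → (2ℚ * n⁻¹) * Σ[ n ] (λ j → 1ℚ - e i j))       ≡⟨ Σ-cong {n} (λ i → *-distribˡ-Σ (2ℚ * n⁻¹) (λ j → 1ℚ - e i j)) ⟩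
    Σ[ n ] (λ i → Σ[ n ] (λ j → (2ℚ * n⁻¹) * (1ℚ - e i j)))     ≤⟨ Σ-mono-≤ (λ i → Σ-mono-≤ (resistance≥2/n*[1-δ] i)) ⟩
    Σ[ n ] (λ i → Σ[ n ] (Ω i))                                 ≡⟨ sym (⟨⟩-ones Ω) ⟩
    ⟨ 1ᵥ ∣ Ω ∣ 1ᵥ ⟩                                             ∎
    where
    open ≤-Reasoning
    regroup : ∀ m t k → 2ℚ * m * (t * k) ≡ k * ((2ℚ * t) * m)
    regroup = solve-∀ ringℚ

-- Resistance curvature
module _ {n : ℕ} {{_ : NonZero n}} (G : SimpleGraph n) {M : Matrix n} {κ : Vector n}
         (curvature : IsResistanceCurvature G M κ) where

  private
    ΓM≡I : ∀ i j → matMul (Gamma G) M i j ≡ idMatrix n i j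
    ΓM≡I = proj₁ (proj₁ curvature)
    Ω : Matrix n
    Ω = resistance M
    N : ℚ
    N = + n / 1
    s : ℚ
    s = Σ[ n ] κ
    S : ℚ
    S = ⟨ 1ᵥ ∣ Ω ∣ 1ᵥ ⟩

  ⟨⟩-resistance-curvature : ∀ a → ⟨ a ∣ Ω ∣ κ ⟩ ≡ Σ[ n ] a
  ⟨⟩-resistance-curvature a = Σ-cong (λ i → trans (cong (_*_ (a i)) (proj₂ curvature i)) (*-identityʳ (a i)))

  -- Test ⟨⟩-resistance-zeroSum on the zero-sum vector x = n κ - (Σ κ) 𝟙.
  Σcurvature*Σresistance≤n² : 0ℚ < s → s * S ≤ N * N
  Σcurvature*Σresistance≤n² 0<s = 0≤q-p⇒p≤q (*-cancelˡ-≤-pos s {{positive 0<s}}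
    (subst₂ _≤_ (sym (*-zeroʳ s)) (sym s*P≡2F)
      (*-preserves-0≤ (nonNegative⁻¹ 2ℚ) (inverse-psd (Gamma-sym G) (Gamma-psd G) ΓM≡I x))))
    where
    x : Vector n
    x = (N *ᵥ κ) -ᵥ (s *ᵥ 1ᵥ)
    P : ℚ
    P = N * N - s * S
    F : ℚ
    F = ⟨ x ∣ M ∣ x ⟩

    Σx≡0 : Σ[ n ] x ≡ 0ℚ
    Σx≡0 = begin
      Σ[ n ] x                                             ≡⟨ Σ-distrib-sub (N *ᵥ κ) (s *ᵥ 1ᵥ) ⟩
      Σ[ n ] (N *ᵥ κ) - Σ[ n ] (s *ᵥ 1ᵥ)                   ≡⟨ cong₂ _-_ (sym (*-distribˡ-Σ N κ)) (Σ-const {n} (s * 1ℚ)) ⟩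
      N * s - N * (s * 1ℚ)                                 ≡⟨ cancel N s ⟩
      0ℚ                                                   ∎
      where
      open ≡-Reasoning
      cancel : ∀ a b → a * b - a * (b * 1ℚ) ≡ 0ℚ
      cancel = solve-∀ ringℚ

    ⟨1ᵥ∣Ω∣x⟩ : ⟨ 1ᵥ ∣ Ω ∣ x ⟩ ≡ P
    ⟨1ᵥ∣Ω∣x⟩ = begin
      ⟨ 1ᵥ ∣ Ω ∣ x ⟩                                       ≡⟨ ⟨⟩-sub-right 1ᵥ Ω (N *ᵥ κ) (s *ᵥ 1ᵥ) ⟩
      ⟨ 1ᵥ ∣ Ω ∣ N *ᵥ κ ⟩ - ⟨ 1ᵥ ∣ Ω ∣ s *ᵥ 1ᵥ ⟩           ≡⟨ cong₂ _-_ (⟨⟩-scale-right 1ᵥ Ω N κ) (⟨⟩-scale-right 1ᵥ Ω s 1ᵥ) ⟩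
      N * ⟨ 1ᵥ ∣ Ω ∣ κ ⟩ - s * S                           ≡⟨ cong (λ y → N * y - s * S) (⟨⟩-resistance-curvature 1ᵥ) ⟩
      N * Σ[ n ] 1ᵥ - s * S                                ≡⟨ cong (λ y → N * y - s * S) (trans (Σ-const {n} 1ℚ) (*-identityʳ N)) ⟩
      P                                                    ∎
      where open ≡-Reasoning

    ⟨x∣Ω∣x⟩≡-sP : ⟨ x ∣ Ω ∣ x ⟩ ≡ - (s * P)
    ⟨x∣Ω∣x⟩≡-sP = begin
      ⟨ x ∣ Ω ∣ x ⟩                                        ≡⟨ ·-sub-left (N *ᵥ κ) (s *ᵥ 1ᵥ) (matVec Ω x) ⟩
      ⟨ N *ᵥ κ ∣ Ω ∣ x ⟩ - ⟨ s *ᵥ 1ᵥ ∣ Ω ∣ x ⟩             ≡⟨ cong₂ _-_ (·-scale-left N κ (matVec Ω x)) (·-scale-left s 1ᵥ (matVec Ω x)) ⟩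
      N * ⟨ κ ∣ Ω ∣ x ⟩ - s * ⟨ 1ᵥ ∣ Ω ∣ x ⟩               ≡⟨ cong₂ (λ a b → N * a - s * b) ⟨κ∣Ω∣x⟩≡0 ⟨1ᵥ∣Ω∣x⟩ ⟩
      N * 0ℚ - s * P                                       ≡⟨ simplify N (s * P) ⟩
      - (s * P)                                            ∎
      where
      open ≡-Reasoning
      ⟨κ∣Ω∣x⟩≡0 : ⟨ κ ∣ Ω ∣ x ⟩ ≡ 0ℚ
      ⟨κ∣Ω∣x⟩≡0 = trans (⟨⟩-sym (resistance-sym G ΓM≡I) κ x) (trans (⟨⟩-resistance-curvature x) Σx≡0)
      simplify : ∀ a b → a * 0ℚ - b ≡ - b
      simplify = solve-∀ ringℚ

    s*P≡2F : s * P ≡ 2ℚ * F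
    s*P≡2F = neg-injective (trans (sym ⟨x∣Ω∣x⟩≡-sP) (⟨⟩-resistance-zeroSum M x Σx≡0))

  resistance-curvature-bound : ∀ {K} → 0ℚ < K → (∀ i → K ≤ κ i) → K * (2ℚ * (N - 1ℚ)) ≤ N
  resistance-curvature-bound {K} 0<K K≤κ = *-cancelˡ-≤-pos N {{normalize-pos n 1}} (begin
    N * (K * (2ℚ * (N - 1ℚ)))   ≡⟨ sym (*-assoc N K (2ℚ * (N - 1ℚ))) ⟩
    (N * K) * (2ℚ * (N - 1ℚ))   ≤⟨ *-monoʳ-≤-nonNeg (2ℚ * (N - 1ℚ)) {{nonNegative 0≤2[N-1]}} nK≤s ⟩
    s * (2ℚ * (N - 1ℚ))         ≤⟨ *-monoˡ-≤-nonNeg s {{nonNegative (<⇒≤ 0<s)}} (Σresistance≥2[n-1] G ΓM≡I) ⟩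
    s * S                       ≤⟨ Σcurvature*Σresistance≤n² 0<s ⟩
    N * N                       ∎)
    where
    open ≤-Reasoning
    nK≤s : N * K ≤ s
    nK≤s = subst (_≤ s) (Σ-const {n} K) (Σ-mono-≤ K≤κ)
    0<s : 0ℚ < s
    0<s = <-≤-trans (positive⁻¹ (N * K) {{pos*pos⇒pos N {{normalize-pos n 1}} K {{positive 0<K}}}}) nK≤s
    0≤2[N-1] : 0ℚ ≤ 2ℚ * (N - 1ℚ)
    0≤2[N-1] = *-preserves-0≤ (nonNegative⁻¹ 2ℚ) (0≤n/1-1 n)

proposition2 : (m : ℕ) → (G : SimpleGraph (suc (suc m))) → Connected G →
    (Γinv : Matrix (suc (suc m))) → (κ : Vector (suc (suc m))) →
    IsResistanceCurvature G Γinv κ →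
    (K : ℚ) → 0ℚ < K → (∀ i → K ≤ κ i) →
    K ≤ ½ * ((+ (suc (suc m))) / (suc m))
-- Connectedness only serves to make Γ invertible, and IsResistanceCurvature already provides Γ⁻¹.
proposition2 m G _ Γinv κ curvature K 0<K K≤κ =
  *-cancelʳ-≤-pos (2ℚ * r) {{pos*pos⇒pos 2ℚ r {{normalize-pos (suc m) 1}}}}
    (subst₂ _≤_ (cong (λ y → K * (2ℚ * y)) (suc/1-1≡n/1 (suc m))) (sym ½q*2r≡n)
      (resistance-curvature-bound G {Γinv} curvature 0<K K≤κ))
  where
  q r : ℚ
  q = + suc (suc m) / suc m
  r = + suc m / 1
  ½q*2r≡n : (½ * q) * (2ℚ * r) ≡ + suc (suc m) / 1
  ½q*2r≡n = trans (halve q r) (i/n*n≡i (+ suc (suc m)) (suc m))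
    where
    halve : ∀ x y → (½ * x) * (2ℚ * y) ≡ x * y
    halve = solve-∀ ringℚ
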